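{- Let $\mathcal{H}=(E,\mathscr{H})$ be a hereditary collection satisfying the point replacement property, and suppose all bases of $\mathcal{H}$ have the same cardinality $k$. Then $\mathcal{H}$ satisfies the basis replacement property: if $\{p\}\in\mathscr{H}$ and $B$ is a basis of $\mathcal{H}$, then there exists $b\in B$ such that $(B\setminus\{b\})\cup\{p\}$ is a basis of $\mathcal{H}$.
   Context: A hereditary collection is a pair $(E,\mathscr{H})$, $E$ a finite set, $\mathscr{H}\subseteq\mathcal{P}(E)$ nonempty and closed under subsets. A basis is an inclusion-maximal member of $\mathscr{H}$. Point replacement: for every $p\in E$ with $\{p\}\in\mathscr{H}$ and every nonempty $J\in\mathscr{H}$ there is $x\in J$ with $(J\setminus\{x\})\cup\{p\}\in\mathscr{H}$. -}

module Defs where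

open import Data.Nat using (ℕ)
open import Data.Fin using (Fin)
open import Data.Fin.Subset using (Subset; _⊆_; _∈_; ⁅_⁆; _∪_; _-_; ∣_∣; Nonempty)
open import Data.Product using (_×_; ∃)

record Hereditary {n : ℕ} (H : Subset n → Set) : Set where
  field
    nonempty : ∃ λ S → H S
    closed   : ∀ {S T : Subset n} → T ⊆ S → H S → H T

IsBasis : {n : ℕ} → (Subset n → Set) → Subset n → Set
IsBasis H B = H B × (∀ {S} → H S → B ⊆ S → S ⊆ B)

PointReplacement : {n : ℕ} → (Subset n → Set) → Set
PointReplacement {n} H =
  ∀ (p : Fin n) (J : Subset n) → H ⁅ p ⁆ → Nonempty J → H J →
  ∃ λ x → x ∈ J × H ((J - x) ∪ ⁅ p ⁆)

BasisReplacement : {n : ℕ} → (Subset n → Set) → Set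
BasisReplacement {n} H =
  ∀ (p : Fin n) (B : Subset n) → H ⁅ p ⁆ → IsBasis H B →
  ∃ λ b → b ∈ B × IsBasis H ((B - b) ∪ ⁅ p ⁆)

-- Every member of H has size at most k, so a member of size k is a basis.
-- Given a basis B and ⁅ p ⁆ ∈ H with p ∉ B, point replacement applied to J = B
-- yields x ∈ B with (B - x) ∪ ⁅ p ⁆ ∈ H, a set of size k again.
module Submission where

open import Defs
open import Data.Nat using (ℕ; suc; _≤_; _≤?_)
open import Data.Nat.Properties using (<-trans; ≤-reflexive; <⇒≱; ≰⇒>)
open import Data.Fin using (Fin) renaming (zero to fzero; suc to fsuc)
open import Data.Fin.Subset using (Subset; ∣_∣; _∈_; _∉_; _⊆_; _⊂_; _-_; _∪_; ⁅_⁆)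
open import Data.Fin.Subset.Properties
  using (_∈?_; nonempty?; x∈⁅x⁆; p─⊥≡p; ∪-identityʳ; p─q⊆p; p⊂q⇒∣p∣<∣q∣)
open import Data.Fin.Subset.Induction using (⊃-wellFounded)
open import Data.Vec.Base using (_∷_; here; there)
open import Data.Bool using (true; false)
open import Data.Product using (_,_)
open import Data.Empty using (⊥; ⊥-elim)
open import Function using (_∘_)
open import Induction.WellFounded using (module All)
open import Relation.Nullary using (yes; no)
open import Relation.Binary.PropositionalEquality using (_≡_; refl; sym; trans; cong; subst)

x∈p⇒p-x∪⁅x⁆≡p : ∀ {n} {x : Fin n} {p : Subset n} → x ∈ p → (p - x) ∪ ⁅ x ⁆ ≡ p
x∈p⇒p-x∪⁅x⁆≡p {p = true ∷ p} here =
  cong (true ∷_) (trans (∪-identityʳ _) (p─⊥≡p p))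
x∈p⇒p-x∪⁅x⁆≡p {p = true  ∷ _} (there x∈p) = cong (true ∷_) (x∈p⇒p-x∪⁅x⁆≡p x∈p)
x∈p⇒p-x∪⁅x⁆≡p {p = false ∷ _} (there x∈p) = cong (false ∷_) (x∈p⇒p-x∪⁅x⁆≡p x∈p)

x∈p⇒suc∣p-x∣≡∣p∣ : ∀ {n} {x : Fin n} {p : Subset n} → x ∈ p → suc ∣ p - x ∣ ≡ ∣ p ∣
x∈p⇒suc∣p-x∣≡∣p∣ {p = true ∷ p} here = cong (λ q → suc ∣ q ∣) (p─⊥≡p p)
x∈p⇒suc∣p-x∣≡∣p∣ {p = true  ∷ _} (there x∈p) = cong suc (x∈p⇒suc∣p-x∣≡∣p∣ x∈p)
x∈p⇒suc∣p-x∣≡∣p∣ {p = false ∷ _} (there x∈p) = x∈p⇒suc∣p-x∣≡∣p∣ x∈p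

x∉p⇒∣p∪⁅x⁆∣≡suc∣p∣ : ∀ {n} {x : Fin n} {p : Subset n} → x ∉ p → ∣ p ∪ ⁅ x ⁆ ∣ ≡ suc ∣ p ∣
x∉p⇒∣p∪⁅x⁆∣≡suc∣p∣ {x = fzero}  {true  ∷ _} x∉p = ⊥-elim (x∉p here)
x∉p⇒∣p∪⁅x⁆∣≡suc∣p∣ {x = fzero}  {false ∷ p} _   = cong (λ q → suc ∣ q ∣) (∪-identityʳ p)
x∉p⇒∣p∪⁅x⁆∣≡suc∣p∣ {x = fsuc _} {true  ∷ _} x∉p = cong suc (x∉p⇒∣p∪⁅x⁆∣≡suc∣p∣ (x∉p ∘ there))
x∉p⇒∣p∪⁅x⁆∣≡suc∣p∣ {x = fsuc _} {false ∷ _} x∉p = x∉p⇒∣p∪⁅x⁆∣≡suc∣p∣ (x∉p ∘ there)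

∣p-x∪⁅y⁆∣≡∣p∣ : ∀ {n} {x y : Fin n} {p : Subset n} → x ∈ p → y ∉ p → ∣ (p - x) ∪ ⁅ y ⁆ ∣ ≡ ∣ p ∣
∣p-x∪⁅y⁆∣≡∣p∣ {x = x} {p = p} x∈p y∉p =
  trans (x∉p⇒∣p∪⁅x⁆∣≡suc∣p∣ (y∉p ∘ p─q⊆p p ⁅ x ⁆)) (x∈p⇒suc∣p-x∣≡∣p∣ x∈p)

module _ {n : ℕ} (H : Subset n → Set) where

  unextendable⇒basis : ∀ {T} → H T → (∀ {S} → H S → T ⊂ S → ⊥) → IsBasis H T
  unextendable⇒basis {T} hT unextendable = hT , maximal
    where
    maximal : ∀ {S} → H S → T ⊆ S → S ⊆ T
    maximal hS T⊆S {i} i∈S with i ∈? T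
    ... | yes i∈T = i∈T
    ... | no  i∉T = ⊥-elim (unextendable hS (T⊆S , i , i∈S , i∉T))

  module _ {k : ℕ} (∣basis∣≡k : ∀ B → IsBasis H B → ∣ B ∣ ≡ k) where

    -- Induction on strict supersets: if ∣ T ∣ > k, every strict superset in H
    -- is even larger, so by induction it does not exist and T is a basis.
    -- This avoids deciding membership in H.
    ∣member∣≤k : ∀ T → H T → ∣ T ∣ ≤ k
    ∣member∣≤k = All.wfRec ⊃-wellFounded _ (λ T → H T → ∣ T ∣ ≤ k) step
      where
      step : ∀ T → (∀ {S} → T ⊂ S → H S → ∣ S ∣ ≤ k) → H T → ∣ T ∣ ≤ k
      step T ih hT with ∣ T ∣ ≤? k
      ... | yes ∣T∣≤k = ∣T∣≤k
      ... | no  ∣T∣≰k = ⊥-elim (∣T∣≰k (≤-reflexive (∣basis∣≡k T (unextendable⇒basis hT tooLarge))))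
        where
        tooLarge : ∀ {S} → H S → T ⊂ S → ⊥
        tooLarge hS T⊂S =
          <⇒≱ (<-trans (≰⇒> ∣T∣≰k) (p⊂q⇒∣p∣<∣q∣ T⊂S)) (ih T⊂S hS)

    ∣member∣≡k⇒basis : ∀ {T} → H T → ∣ T ∣ ≡ k → IsBasis H T
    ∣member∣≡k⇒basis {T} hT ∣T∣≡k = unextendable⇒basis hT λ {S} hS T⊂S →
      <⇒≱ (p⊂q⇒∣p∣<∣q∣ T⊂S) (subst (∣ S ∣ ≤_) (sym ∣T∣≡k) (∣member∣≤k S hS))

proposition2p19 : {n : ℕ} (H : Subset n → Set) (k : ℕ) →
    Hereditary H → PointReplacement H →
    (∀ B → IsBasis H B → ∣ B ∣ ≡ k) →
    BasisReplacement H
proposition2p19 H k _ pointReplacement ∣basis∣≡k p B h⁅p⁆ basisB@(hB , maximalB) with p ∈? B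
... | yes p∈B = p , p∈B , subst (IsBasis H) (sym (x∈p⇒p-x∪⁅x⁆≡p p∈B)) basisB
... | no  p∉B with nonempty? B
...   | no  empty = ⊥-elim (p∉B (maximalB h⁅p⁆ (λ x∈B → ⊥-elim (empty (_ , x∈B))) (x∈⁅x⁆ p)))
...   | yes nonempty with pointReplacement p B h⁅p⁆ nonempty hB
...     | x , x∈B , hB′ = x , x∈B , ∣member∣≡k⇒basis H ∣basis∣≡k hB′
                              (trans (∣p-x∪⁅y⁆∣≡∣p∣ x∈B p∉B) (∣basis∣≡k B basisB))
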